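{- $\text{E-HA}^{\omega*}_{\mathrm{st}} + \mathsf{HGMP}^{\mathrm{st}} + \mathsf{R} \vdash \mathsf{US}^*$, where, for all types $\sigma,\tau$ and internal formulae $\varphi,\psi$: $\mathsf{HGMP}^{\mathrm{st}}$: $(\forall^{\mathrm{st}} x:\sigma \, \varphi(x) \to \psi) \to \exists^{\mathrm{st}} s: \sigma^* \, (\forall x \in s \, \varphi(x) \to \psi)$; $\mathsf{R}$: $\forall y: \tau\, \exists^{\mathrm{st}} x: \sigma \, \varphi(x,y) \to \exists^{\mathrm{st}} s: \sigma^* \, \forall y: \tau\, \exists x \in s \, \varphi(x,y)$; $\mathsf{US}^*$: $\forall s:\sigma^*\,(\mathrm{hyper}_\sigma(s) \to \varphi(s)) \to \exists^{\mathrm{st}} s:\sigma^* \,\varphi(s)$.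
   Context: $\text{E-HA}^{\omega*}$ is extensional Heyting arithmetic in all finite types over the types generated by $0$, $\sigma\to\tau$ and $\sigma^*$ (finite sequences), with constants for the empty sequence, prepending, a list recursor, and the axiom that every sequence is empty or a prepend; $|s|$, $s_i$, $s\cdot t$ denote length, projection, concatenation, $a\in s :\equiv \exists i<|s|\,(a=s_i)$ and $s'\subseteq s :\equiv \forall x(x\in s'\to x\in s)$. $\text{E-HA}^{\omega*}_{\mathrm{st}}$ adds predicates $\mathrm{st}_\sigma$ and external quantifiers $\forall^{\mathrm{st}}x\,\Phi :\leftrightarrow \forall x(\mathrm{st}(x)\to\Phi)$, $\exists^{\mathrm{st}}x\,\Phi :\leftrightarrow \exists x(\mathrm{st}(x)\land\Phi)$; internal formulae are those not containing $\mathrm{st}$. Axioms: those of $\text{E-HA}^{\omega*}$ (induction only for internal formulae), $\mathrm{st}(x)\land x=y\to\mathrm{st}(y)$, $\mathrm{st}(a)$ for closed terms $a$, $\mathrm{st}(f)\land\mathrm{st}(x)\to\mathrm{st}(fx)$, and external induction for all formulae. $\mathrm{hyper}_\sigma(s) :\equiv \forall^{\mathrm{st}}x:\sigma\,(x\in s)$. -}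

module Defs where

open import Data.List using (List; []; _∷_; map)
open import Data.List.Membership.Propositional using (_∈_)

infixr 7 _⇒_
infix 8 _*

data Ty : Set where
  ι   : Ty
  _⇒_ : Ty → Ty → Ty
  _*  : Ty → Ty

Ctx : Set
Ctx = List Ty

infix 4 _∋_
data _∋_ : Ctx → Ty → Set where
  here  : ∀ {Γ σ} → (σ ∷ Γ) ∋ σ
  there : ∀ {Γ σ τ} → Γ ∋ σ → (τ ∷ Γ) ∋ σ

-- Terms (λ-terms; equivalent to the combinator presentation)

infixl 9 _·_
data Tm (Γ : Ctx) : Ty → Set where
  var  : ∀ {σ} → Γ ∋ σ → Tm Γ σ
  lam  : ∀ {σ τ} → Tm (σ ∷ Γ) τ → Tm Γ (σ ⇒ τ)
  _·_  : ∀ {σ τ} → Tm Γ (σ ⇒ τ) → Tm Γ σ → Tm Γ τ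
  zer  : Tm Γ ι
  suc  : Tm Γ (ι ⇒ ι)
  rec  : ∀ σ → Tm Γ (σ ⇒ (ι ⇒ σ ⇒ σ) ⇒ ι ⇒ σ)
  nil  : ∀ σ → Tm Γ (σ *)
  cons : ∀ σ → Tm Γ (σ ⇒ σ * ⇒ σ *)
  lrec : ∀ σ τ → Tm Γ (τ ⇒ (σ ⇒ σ * ⇒ τ ⇒ τ) ⇒ σ * ⇒ τ)

Ren : Ctx → Ctx → Set
Ren Γ Δ = ∀ {σ} → Γ ∋ σ → Δ ∋ σ

extR : ∀ {Γ Δ τ} → Ren Γ Δ → Ren (τ ∷ Γ) (τ ∷ Δ)
extR ρ here      = here
extR ρ (there x) = there (ρ x)

ren : ∀ {Γ Δ σ} → Ren Γ Δ → Tm Γ σ → Tm Δ σ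
ren ρ (var x)    = var (ρ x)
ren ρ (lam t)    = lam (ren (extR ρ) t)
ren ρ (t · u)    = ren ρ t · ren ρ u
ren ρ zer        = zer
ren ρ suc        = suc
ren ρ (rec σ)    = rec σ
ren ρ (nil σ)    = nil σ
ren ρ (cons σ)   = cons σ
ren ρ (lrec σ τ) = lrec σ τ

wk : ∀ {Γ σ τ} → Tm Γ σ → Tm (τ ∷ Γ) σ
wk = ren there

Sub : Ctx → Ctx → Set
Sub Γ Δ = ∀ {σ} → Γ ∋ σ → Tm Δ σ

extS : ∀ {Γ Δ τ} → Sub Γ Δ → Sub (τ ∷ Γ) (τ ∷ Δ)
extS θ here      = var here
extS θ (there x) = wk (θ x)

sub : ∀ {Γ Δ σ} → Sub Γ Δ → Tm Γ σ → Tm Δ σ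
sub θ (var x)    = θ x
sub θ (lam t)    = lam (sub (extS θ) t)
sub θ (t · u)    = sub θ t · sub θ u
sub θ zer        = zer
sub θ suc        = suc
sub θ (rec σ)    = rec σ
sub θ (nil σ)    = nil σ
sub θ (cons σ)   = cons σ
sub θ (lrec σ τ) = lrec σ τ

sub0 : ∀ {Γ σ} → Tm Γ σ → Sub (σ ∷ Γ) Γ
sub0 t here      = t
sub0 t (there x) = var x

_[_]ₜ : ∀ {Γ σ τ} → Tm (σ ∷ Γ) τ → Tm Γ σ → Tm Γ τ
t [ u ]ₜ = sub (sub0 u) t

noVar : ∀ {Γ} → Ren [] Γ
noVar ()

close : ∀ {Γ σ} → Tm [] σ → Tm Γ σ
close = ren noVar

infix 6 _≐_
infixr 5 _∧'_
infixr 4 _∨'_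
infixr 3 _⊃_

data Fm (Γ : Ctx) : Set where
  _≐_  : ∀ {σ} → Tm Γ σ → Tm Γ σ → Fm Γ
  ⊥'   : Fm Γ
  _∧'_ : Fm Γ → Fm Γ → Fm Γ
  _∨'_ : Fm Γ → Fm Γ → Fm Γ
  _⊃_  : Fm Γ → Fm Γ → Fm Γ
  ∀'   : ∀ σ → Fm (σ ∷ Γ) → Fm Γ
  ∃'   : ∀ σ → Fm (σ ∷ Γ) → Fm Γ
  st   : ∀ {σ} → Tm Γ σ → Fm Γ

data Internal {Γ : Ctx} : Fm Γ → Set where
  i≐ : ∀ {σ} {s t : Tm Γ σ} → Internal (s ≐ t)
  i⊥ : Internal ⊥'
  i∧ : ∀ {A B} → Internal A → Internal B → Internal (A ∧' B)
  i∨ : ∀ {A B} → Internal A → Internal B → Internal (A ∨' B)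
  i⊃ : ∀ {A B} → Internal A → Internal B → Internal (A ⊃ B)
  i∀ : ∀ {σ A} → Internal {σ ∷ Γ} A → Internal (∀' σ A)
  i∃ : ∀ {σ A} → Internal {σ ∷ Γ} A → Internal (∃' σ A)

renF : ∀ {Γ Δ} → Ren Γ Δ → Fm Γ → Fm Δ
renF ρ (s ≐ t)  = ren ρ s ≐ ren ρ t
renF ρ ⊥'       = ⊥'
renF ρ (A ∧' B) = renF ρ A ∧' renF ρ B
renF ρ (A ∨' B) = renF ρ A ∨' renF ρ B
renF ρ (A ⊃ B)  = renF ρ A ⊃ renF ρ B
renF ρ (∀' σ A) = ∀' σ (renF (extR ρ) A)
renF ρ (∃' σ A) = ∃' σ (renF (extR ρ) A)
renF ρ (st t)   = st (ren ρ t)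

wkF : ∀ {Γ τ} → Fm Γ → Fm (τ ∷ Γ)
wkF = renF there

subF : ∀ {Γ Δ} → Sub Γ Δ → Fm Γ → Fm Δ
subF θ (s ≐ t)  = sub θ s ≐ sub θ t
subF θ ⊥'       = ⊥'
subF θ (A ∧' B) = subF θ A ∧' subF θ B
subF θ (A ∨' B) = subF θ A ∨' subF θ B
subF θ (A ⊃ B)  = subF θ A ⊃ subF θ B
subF θ (∀' σ A) = ∀' σ (subF (extS θ) A)
subF θ (∃' σ A) = ∃' σ (subF (extS θ) A)
subF θ (st t)   = st (sub θ t)

_[_] : ∀ {Γ σ} → Fm (σ ∷ Γ) → Tm Γ σ → Fm Γ
A [ t ] = subF (sub0 t) A

succSub : ∀ {Γ} → Sub (ι ∷ Γ) (ι ∷ Γ)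
succSub here      = suc · var here
succSub (there x) = var (there x)

∀st : ∀ {Γ} σ → Fm (σ ∷ Γ) → Fm Γ
∀st σ A = ∀' σ (st (var here) ⊃ A)

∃st : ∀ {Γ} σ → Fm (σ ∷ Γ) → Fm Γ
∃st σ A = ∃' σ (st (var here) ∧' A)

v0 : ∀ {Γ σ} → Tm (σ ∷ Γ) σ
v0 = var here

v1 : ∀ {Γ σ τ} → Tm (τ ∷ σ ∷ Γ) σ
v1 = var (there here)

v2 : ∀ {Γ σ τ ρ} → Tm (ρ ∷ τ ∷ σ ∷ Γ) σ
v2 = var (there (there here))

plus : ∀ {Γ} → Tm Γ (ι ⇒ ι ⇒ ι)
plus = lam (lam (rec ι · v1 · lam (lam (suc · v0)) · v0))

_<'_ : ∀ {Γ} → Tm Γ ι → Tm Γ ι → Fm Γ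
i <' n = ∃' ι (suc · (plus · wk i · v0) ≐ wk n)

-- a canonical closed element of each type (default value for projections)
dflt : ∀ {Γ} σ → Tm Γ σ
dflt ι       = zer
dflt (σ ⇒ τ) = lam (dflt τ)
dflt (σ *)   = nil σ

len : ∀ {Γ σ} → Tm Γ (σ *) → Tm Γ ι
len {σ = σ} s = lrec σ ι · zer · lam (lam (lam (suc · v0))) · s

-- projection s_i  ((x∷t)_0 = x, (x∷t)_{i+1} = t_i, default outside range)
proj : ∀ {Γ σ} → Tm Γ (σ *) → Tm Γ ι → Tm Γ σ
proj {σ = σ} s i =
  lrec σ (ι ⇒ σ)
    · lam (dflt σ)
    · lam (lam (lam (lam (rec σ · var (there (there (there here)))
                               · lam (lam (var (there (there (there here))) · v1))
                               · v0))))
    · s · i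

mem : ∀ {Γ σ} → Tm Γ σ → Tm Γ (σ *) → Fm Γ
mem a s = ∃' ι ((v0 <' len (wk s)) ∧' (wk a ≐ proj (wk s) v0))

hyper : ∀ {Γ} σ → Tm Γ (σ *) → Fm Γ
hyper σ s = ∀st σ (mem v0 (wk s))

-- renaming used in R: (x:σ, y:τ, Γ) ↦ (x:σ, y:τ, s:σ*, Γ)
skip2 : ∀ {Γ σ τ ρ} → Ren (σ ∷ τ ∷ Γ) (σ ∷ τ ∷ ρ ∷ Γ)
skip2 = extR (extR there)

data Axiom {Γ : Ctx} : Fm Γ → Set where
  eq-refl   : ∀ {σ} (t : Tm Γ σ) → Axiom (t ≐ t)
  eq-subst  : ∀ {σ} (A : Fm (σ ∷ Γ)) → Internal A → (s t : Tm Γ σ) →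
              Axiom (s ≐ t ⊃ A [ s ] ⊃ A [ t ])
  funext    : ∀ {σ τ} (f g : Tm Γ (σ ⇒ τ)) →
              Axiom (∀' σ (wk f · v0 ≐ wk g · v0) ⊃ f ≐ g)
  beta      : ∀ {σ τ} (t : Tm (σ ∷ Γ) τ) (u : Tm Γ σ) → Axiom (lam t · u ≐ t [ u ]ₜ)
  suc-nz    : (t : Tm Γ ι) → Axiom (suc · t ≐ zer ⊃ ⊥')
  suc-inj   : (s t : Tm Γ ι) → Axiom (suc · s ≐ suc · t ⊃ s ≐ t)
  rec-zer   : ∀ {σ} a f → Axiom (rec σ · a · f · zer ≐ a)
  rec-suc   : ∀ {σ} a f n → Axiom (rec σ · a · f · (suc · n) ≐ f · n · (rec σ · a · f · n))
  lrec-nil  : ∀ {σ τ} a f → Axiom (lrec σ τ · a · f · nil σ ≐ a)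
  lrec-cons : ∀ {σ τ} a f x s →
              Axiom (lrec σ τ · a · f · (cons σ · x · s) ≐ f · x · s · (lrec σ τ · a · f · s))
  seq-cases : ∀ {σ} (s : Tm Γ (σ *)) →
              Axiom (s ≐ nil σ ∨' ∃' σ (∃' (σ *) (wk (wk s) ≐ cons σ · v1 · v0)))
  ind       : (A : Fm (ι ∷ Γ)) → Internal A →
              Axiom (A [ zer ] ⊃ ∀' ι (A ⊃ subF succSub A) ⊃ ∀' ι A)
  st-eq     : ∀ {σ} (s t : Tm Γ σ) → Axiom (st s ∧' s ≐ t ⊃ st t)
  st-closed : ∀ {σ} (a : Tm [] σ) → Axiom (st (close {Γ} a))
  st-app    : ∀ {σ τ} (f : Tm Γ (σ ⇒ τ)) (x : Tm Γ σ) → Axiom (st f ∧' st x ⊃ st (f · x))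
  ind-st    : (A : Fm (ι ∷ Γ)) →
              Axiom (A [ zer ] ⊃ ∀st ι (A ⊃ subF succSub A) ⊃ ∀st ι A)
  hgmp      : ∀ {σ} (φ : Fm (σ ∷ Γ)) (ψ : Fm Γ) → Internal φ → Internal ψ →
              Axiom ((∀st σ φ ⊃ ψ) ⊃
                     ∃st (σ *) (∀' σ (mem v0 v1 ⊃ renF (extR there) φ) ⊃ wkF ψ))
  R         : ∀ {σ τ} (φ : Fm (σ ∷ τ ∷ Γ)) → Internal φ →
              Axiom (∀' τ (∃st σ φ) ⊃
                     ∃st (σ *) (∀' τ (∃' σ (mem v0 v2 ∧' renF skip2 φ))))

infix 2 _⊢_
data _⊢_ {Γ : Ctx} (Δ : List (Fm Γ)) : Fm Γ → Set where
  hyp  : ∀ {A} → A ∈ Δ → Δ ⊢ A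
  ax   : ∀ {A} → Axiom A → Δ ⊢ A
  ⊥E   : ∀ {A} → Δ ⊢ ⊥' → Δ ⊢ A
  ∧I   : ∀ {A B} → Δ ⊢ A → Δ ⊢ B → Δ ⊢ A ∧' B
  ∧E₁  : ∀ {A B} → Δ ⊢ A ∧' B → Δ ⊢ A
  ∧E₂  : ∀ {A B} → Δ ⊢ A ∧' B → Δ ⊢ B
  ∨I₁  : ∀ {A B} → Δ ⊢ A → Δ ⊢ A ∨' B
  ∨I₂  : ∀ {A B} → Δ ⊢ B → Δ ⊢ A ∨' B
  ∨E   : ∀ {A B C} → Δ ⊢ A ∨' B → (A ∷ Δ) ⊢ C → (B ∷ Δ) ⊢ C → Δ ⊢ C
  ⊃I   : ∀ {A B} → (A ∷ Δ) ⊢ B → Δ ⊢ A ⊃ B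
  ⊃E   : ∀ {A B} → Δ ⊢ A ⊃ B → Δ ⊢ A → Δ ⊢ B
  ∀I   : ∀ {σ A} → map wkF Δ ⊢ A → Δ ⊢ ∀' σ A
  ∀E   : ∀ {σ A} → Δ ⊢ ∀' σ A → (t : Tm Γ σ) → Δ ⊢ A [ t ]
  ∃I   : ∀ {σ A} (t : Tm Γ σ) → Δ ⊢ A [ t ] → Δ ⊢ ∃' σ A
  ∃E   : ∀ {σ A B} → Δ ⊢ ∃' σ A → (A ∷ map wkF Δ) ⊢ wkF B → Δ ⊢ B

US* : ∀ {Γ} σ → Fm (σ * ∷ Γ) → Fm Γ
US* σ φ = ∀' (σ *) (hyper σ v0 ⊃ φ) ⊃ ∃st (σ *) φ

module Submission where

-- Assume ∀s (hyper(s) → φ(s)).  For each s, hyper(s) is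
-- ∀^st x (x ∈ s), so HGMP^st with φ(x) :≡ x ∈ s and ψ :≡ φ(s) gives a standard
-- t with (t ⊆ s → φ(s)).  Thus ∀s ∃^st t (t ⊆ s → φ(s)), an internal matrix, and
-- R collects the witnesses into one standard list T with
-- ∀s ∃t ∈ T (t ⊆ s → φ(s)).  The flattening u := flat(T) is standard (a closed
-- term applied to T) and contains every t ∈ T; taking s := u gives φ(u).

open import Defs
open import Data.List using (List; []; _∷_; map)
import Data.List.Relation.Unary.Any as Any
open import Relation.Binary.PropositionalEquality using (_≡_; refl; cong; cong₂; sym; trans)

-- 1. Substitution calculus

_≗ᴿ_ : ∀ {Γ Δ} → Ren Γ Δ → Ren Γ Δ → Set
ρ ≗ᴿ ρ' = ∀ {σ} (x : _ ∋ σ) → ρ x ≡ ρ' x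

_≗ˢ_ : ∀ {Γ Δ} → Sub Γ Δ → Sub Γ Δ → Set
θ ≗ˢ θ' = ∀ {σ} (x : _ ∋ σ) → θ x ≡ θ' x

extR-cong : ∀ {Γ Δ τ} {ρ ρ' : Ren Γ Δ} → ρ ≗ᴿ ρ' → extR {τ = τ} ρ ≗ᴿ extR ρ'
extR-cong e here      = refl
extR-cong e (there x) = cong there (e x)

ren-cong : ∀ {Γ Δ σ} {ρ ρ' : Ren Γ Δ} → ρ ≗ᴿ ρ' → (t : Tm Γ σ) → ren ρ t ≡ ren ρ' t
ren-cong e (var x)    = cong var (e x)
ren-cong e (lam t)    = cong lam (ren-cong (extR-cong e) t)
ren-cong e (t · u)    = cong₂ _·_ (ren-cong e t) (ren-cong e u)
ren-cong e zer        = refl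
ren-cong e suc        = refl
ren-cong e (rec σ)    = refl
ren-cong e (nil σ)    = refl
ren-cong e (cons σ)   = refl
ren-cong e (lrec σ τ) = refl

extS-cong : ∀ {Γ Δ τ} {θ θ' : Sub Γ Δ} → θ ≗ˢ θ' → extS {τ = τ} θ ≗ˢ extS θ'
extS-cong e here      = refl
extS-cong e (there x) = cong wk (e x)

sub-cong : ∀ {Γ Δ σ} {θ θ' : Sub Γ Δ} → θ ≗ˢ θ' → (t : Tm Γ σ) → sub θ t ≡ sub θ' t
sub-cong e (var x)    = e x
sub-cong e (lam t)    = cong lam (sub-cong (extS-cong e) t)
sub-cong e (t · u)    = cong₂ _·_ (sub-cong e t) (sub-cong e u)
sub-cong e zer        = refl
sub-cong e suc        = refl
sub-cong e (rec σ)    = refl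
sub-cong e (nil σ)    = refl
sub-cong e (cons σ)   = refl
sub-cong e (lrec σ τ) = refl

ren-ren : ∀ {Γ Δ Θ σ} (ρ : Ren Δ Θ) (ρ' : Ren Γ Δ) (t : Tm Γ σ) →
  ren ρ (ren ρ' t) ≡ ren (λ x → ρ (ρ' x)) t
ren-ren ρ ρ' (var x)    = refl
ren-ren ρ ρ' (lam t)    = cong lam (trans (ren-ren (extR ρ) (extR ρ') t)
  (ren-cong (λ { here → refl ; (there x) → refl }) t))
ren-ren ρ ρ' (t · u)    = cong₂ _·_ (ren-ren ρ ρ' t) (ren-ren ρ ρ' u)
ren-ren ρ ρ' zer        = refl
ren-ren ρ ρ' suc        = refl
ren-ren ρ ρ' (rec σ)    = refl
ren-ren ρ ρ' (nil σ)    = refl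
ren-ren ρ ρ' (cons σ)   = refl
ren-ren ρ ρ' (lrec σ τ) = refl

sub-ren : ∀ {Γ Δ Θ σ} (θ : Sub Δ Θ) (ρ : Ren Γ Δ) (t : Tm Γ σ) →
  sub θ (ren ρ t) ≡ sub (λ x → θ (ρ x)) t
sub-ren θ ρ (var x)    = refl
sub-ren θ ρ (lam t)    = cong lam (trans (sub-ren (extS θ) (extR ρ) t)
  (sub-cong (λ { here → refl ; (there x) → refl }) t))
sub-ren θ ρ (t · u)    = cong₂ _·_ (sub-ren θ ρ t) (sub-ren θ ρ u)
sub-ren θ ρ zer        = refl
sub-ren θ ρ suc        = refl
sub-ren θ ρ (rec σ)    = refl
sub-ren θ ρ (nil σ)    = refl
sub-ren θ ρ (cons σ)   = refl
sub-ren θ ρ (lrec σ τ) = refl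

ren-sub : ∀ {Γ Δ Θ σ} (ρ : Ren Δ Θ) (θ : Sub Γ Δ) (t : Tm Γ σ) →
  ren ρ (sub θ t) ≡ sub (λ x → ren ρ (θ x)) t
ren-sub ρ θ (var x)    = refl
ren-sub ρ θ (lam t)    = cong lam (trans (ren-sub (extR ρ) (extS θ) t)
  (sub-cong (λ { here → refl ; (there x) → trans (ren-ren (extR ρ) there (θ x))
                                                  (sym (ren-ren there ρ (θ x))) }) t))
ren-sub ρ θ (t · u)    = cong₂ _·_ (ren-sub ρ θ t) (ren-sub ρ θ u)
ren-sub ρ θ zer        = refl
ren-sub ρ θ suc        = refl
ren-sub ρ θ (rec σ)    = refl
ren-sub ρ θ (nil σ)    = refl
ren-sub ρ θ (cons σ)   = refl
ren-sub ρ θ (lrec σ τ) = refl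

extS-∘ : ∀ {Γ Δ Θ τ} (θ : Sub Δ Θ) (θ' : Sub Γ Δ) →
  (λ {σ} (x : (τ ∷ Γ) ∋ σ) → sub (extS θ) (extS θ' x)) ≗ˢ extS (λ x → sub θ (θ' x))
extS-∘ θ θ' here      = refl
extS-∘ θ θ' (there x) = trans (sub-ren (extS θ) there (θ' x)) (sym (ren-sub there θ (θ' x)))

sub-sub : ∀ {Γ Δ Θ σ} (θ : Sub Δ Θ) (θ' : Sub Γ Δ) (t : Tm Γ σ) →
  sub θ (sub θ' t) ≡ sub (λ x → sub θ (θ' x)) t
sub-sub θ θ' (var x)    = refl
sub-sub θ θ' (lam t)    = cong lam (trans (sub-sub (extS θ) (extS θ') t) (sub-cong (extS-∘ θ θ') t))
sub-sub θ θ' (t · u)    = cong₂ _·_ (sub-sub θ θ' t) (sub-sub θ θ' u)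
sub-sub θ θ' zer        = refl
sub-sub θ θ' suc        = refl
sub-sub θ θ' (rec σ)    = refl
sub-sub θ θ' (nil σ)    = refl
sub-sub θ θ' (cons σ)   = refl
sub-sub θ θ' (lrec σ τ) = refl

sub-var : ∀ {Γ σ} (t : Tm Γ σ) → sub var t ≡ t
sub-var (var x)    = refl
sub-var (lam t)    = cong lam (trans (sub-cong (λ { here → refl ; (there x) → refl }) t) (sub-var t))
sub-var (t · u)    = cong₂ _·_ (sub-var t) (sub-var u)
sub-var zer        = refl
sub-var suc        = refl
sub-var (rec σ)    = refl
sub-var (nil σ)    = refl
sub-var (cons σ)   = refl
sub-var (lrec σ τ) = refl

ren-as-sub : ∀ {Γ Δ σ} (ρ : Ren Γ Δ) (t : Tm Γ σ) → ren ρ t ≡ sub (λ x → var (ρ x)) t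
ren-as-sub ρ t = trans (sym (sub-var (ren ρ t))) (sub-ren var ρ t)

sub0-wk : ∀ {Γ σ τ} (u : Tm Γ τ) (t : Tm Γ σ) → sub (sub0 u) (wk t) ≡ t
sub0-wk u t = trans (sub-ren (sub0 u) there t) (sub-var t)

subF-cong : ∀ {Γ Δ} {θ θ' : Sub Γ Δ} → θ ≗ˢ θ' → (A : Fm Γ) → subF θ A ≡ subF θ' A
subF-cong e (s ≐ t)  = cong₂ _≐_ (sub-cong e s) (sub-cong e t)
subF-cong e ⊥'       = refl
subF-cong e (A ∧' B) = cong₂ _∧'_ (subF-cong e A) (subF-cong e B)
subF-cong e (A ∨' B) = cong₂ _∨'_ (subF-cong e A) (subF-cong e B)
subF-cong e (A ⊃ B)  = cong₂ _⊃_ (subF-cong e A) (subF-cong e B)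
subF-cong e (∀' σ A) = cong (∀' σ) (subF-cong (extS-cong e) A)
subF-cong e (∃' σ A) = cong (∃' σ) (subF-cong (extS-cong e) A)
subF-cong e (st t)   = cong st (sub-cong e t)

subF-renF : ∀ {Γ Δ Θ} (θ : Sub Δ Θ) (ρ : Ren Γ Δ) (A : Fm Γ) →
  subF θ (renF ρ A) ≡ subF (λ x → θ (ρ x)) A
subF-renF θ ρ (s ≐ t)  = cong₂ _≐_ (sub-ren θ ρ s) (sub-ren θ ρ t)
subF-renF θ ρ ⊥'       = refl
subF-renF θ ρ (A ∧' B) = cong₂ _∧'_ (subF-renF θ ρ A) (subF-renF θ ρ B)
subF-renF θ ρ (A ∨' B) = cong₂ _∨'_ (subF-renF θ ρ A) (subF-renF θ ρ B)
subF-renF θ ρ (A ⊃ B)  = cong₂ _⊃_ (subF-renF θ ρ A) (subF-renF θ ρ B)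
subF-renF θ ρ (∀' σ A) = cong (∀' σ) (trans (subF-renF (extS θ) (extR ρ) A)
  (subF-cong (λ { here → refl ; (there x) → refl }) A))
subF-renF θ ρ (∃' σ A) = cong (∃' σ) (trans (subF-renF (extS θ) (extR ρ) A)
  (subF-cong (λ { here → refl ; (there x) → refl }) A))
subF-renF θ ρ (st t)   = cong st (sub-ren θ ρ t)

subF-subF : ∀ {Γ Δ Θ} (θ : Sub Δ Θ) (θ' : Sub Γ Δ) (A : Fm Γ) →
  subF θ (subF θ' A) ≡ subF (λ x → sub θ (θ' x)) A
subF-subF θ θ' (s ≐ t)  = cong₂ _≐_ (sub-sub θ θ' s) (sub-sub θ θ' t)
subF-subF θ θ' ⊥'       = refl
subF-subF θ θ' (A ∧' B) = cong₂ _∧'_ (subF-subF θ θ' A) (subF-subF θ θ' B)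
subF-subF θ θ' (A ∨' B) = cong₂ _∨'_ (subF-subF θ θ' A) (subF-subF θ θ' B)
subF-subF θ θ' (A ⊃ B)  = cong₂ _⊃_ (subF-subF θ θ' A) (subF-subF θ θ' B)
subF-subF θ θ' (∀' σ A) = cong (∀' σ) (trans (subF-subF (extS θ) (extS θ') A) (subF-cong (extS-∘ θ θ') A))
subF-subF θ θ' (∃' σ A) = cong (∃' σ) (trans (subF-subF (extS θ) (extS θ') A) (subF-cong (extS-∘ θ θ') A))
subF-subF θ θ' (st t)   = cong st (sub-sub θ θ' t)

subF-var : ∀ {Γ} (A : Fm Γ) → subF var A ≡ A
subF-var (s ≐ t)  = cong₂ _≐_ (sub-var s) (sub-var t)
subF-var ⊥'       = refl
subF-var (A ∧' B) = cong₂ _∧'_ (subF-var A) (subF-var B)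
subF-var (A ∨' B) = cong₂ _∨'_ (subF-var A) (subF-var B)
subF-var (A ⊃ B)  = cong₂ _⊃_ (subF-var A) (subF-var B)
subF-var (∀' σ A) = cong (∀' σ) (trans (subF-cong (λ { here → refl ; (there x) → refl }) A) (subF-var A))
subF-var (∃' σ A) = cong (∃' σ) (trans (subF-cong (λ { here → refl ; (there x) → refl }) A) (subF-var A))
subF-var (st t)   = cong st (sub-var t)

renF-as-subF : ∀ {Γ Δ} (ρ : Ren Γ Δ) (A : Fm Γ) → renF ρ A ≡ subF (λ x → var (ρ x)) A
renF-as-subF ρ A = trans (sym (subF-var (renF ρ A))) (subF-renF var ρ A)

renF-renF : ∀ {Γ Δ Θ} (ρ : Ren Δ Θ) (ρ' : Ren Γ Δ) (A : Fm Γ) →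
  renF ρ (renF ρ' A) ≡ renF (λ x → ρ (ρ' x)) A
renF-renF ρ ρ' A =
  trans (renF-as-subF ρ (renF ρ' A)) (trans (subF-renF _ ρ' A) (sym (renF-as-subF _ A)))

renF-subF : ∀ {Γ Δ Θ} (ρ : Ren Δ Θ) (θ : Sub Γ Δ) (A : Fm Γ) →
  renF ρ (subF θ A) ≡ subF (λ x → ren ρ (θ x)) A
renF-subF ρ θ A = trans (renF-as-subF ρ (subF θ A))
  (trans (subF-subF _ θ A) (subF-cong (λ x → sym (ren-as-sub ρ (θ x))) A))

renF-internal : ∀ {Γ Δ} (ρ : Ren Γ Δ) {A : Fm Γ} → Internal A → Internal (renF ρ A)
renF-internal ρ i≐       = i≐
renF-internal ρ i⊥       = i⊥
renF-internal ρ (i∧ a b) = i∧ (renF-internal ρ a) (renF-internal ρ b)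
renF-internal ρ (i∨ a b) = i∨ (renF-internal ρ a) (renF-internal ρ b)
renF-internal ρ (i⊃ a b) = i⊃ (renF-internal ρ a) (renF-internal ρ b)
renF-internal ρ (i∀ a)   = i∀ (renF-internal (extR ρ) a)
renF-internal ρ (i∃ a)   = i∃ (renF-internal (extR ρ) a)

-- The default constant is closed, so renaming and substitution fix it
-- (propositionally; definitionally only for a concrete type).
ren-dflt : ∀ {Γ Δ} (ρ : Ren Γ Δ) σ → ren ρ (dflt σ) ≡ dflt σ
ren-dflt ρ ι       = refl
ren-dflt ρ (σ ⇒ τ) = cong lam (ren-dflt (extR ρ) τ)
ren-dflt ρ (σ *)   = refl

sub-dflt : ∀ {Γ Δ} (θ : Sub Γ Δ) σ → sub θ (dflt σ) ≡ dflt σ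
sub-dflt θ ι       = refl
sub-dflt θ (σ ⇒ τ) = cong lam (sub-dflt (extS θ) τ)
sub-dflt θ (σ *)   = refl

-- The same, stated for a term already known to be the default constant, so
-- that a chain of renamings and substitutions can be peeled off one by one.
ren-isDflt : ∀ {Γ Δ σ} {t : Tm Γ σ} (ρ : Ren Γ Δ) → t ≡ dflt σ → ren ρ t ≡ dflt σ
ren-isDflt {σ = σ} ρ refl = ren-dflt ρ σ

sub-isDflt : ∀ {Γ Δ σ} {t : Tm Γ σ} (θ : Sub Γ Δ) → t ≡ dflt σ → sub θ t ≡ dflt σ
sub-isDflt {σ = σ} θ refl = sub-dflt θ σ

-- 2. Derived rules of the deductive calculus

h0 : ∀ {Γ} {Δ : List (Fm Γ)} {A} → (A ∷ Δ) ⊢ A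
h0 = hyp (Any.here refl)

h1 : ∀ {Γ} {Δ : List (Fm Γ)} {A B} → (B ∷ A ∷ Δ) ⊢ A
h1 = hyp (Any.there (Any.here refl))

h2 : ∀ {Γ} {Δ : List (Fm Γ)} {A B C} → (C ∷ B ∷ A ∷ Δ) ⊢ A
h2 = hyp (Any.there (Any.there (Any.here refl)))

h3 : ∀ {Γ} {Δ : List (Fm Γ)} {A B C D} → (D ∷ C ∷ B ∷ A ∷ Δ) ⊢ A
h3 = hyp (Any.there (Any.there (Any.there (Any.here refl))))

h4 : ∀ {Γ} {Δ : List (Fm Γ)} {A B C D E} → (E ∷ D ∷ C ∷ B ∷ A ∷ Δ) ⊢ A
h4 = hyp (Any.there (Any.there (Any.there (Any.there (Any.here refl)))))

h5 : ∀ {Γ} {Δ : List (Fm Γ)} {A B C D E F} → (F ∷ E ∷ D ∷ C ∷ B ∷ A ∷ Δ) ⊢ A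
h5 = hyp (Any.there (Any.there (Any.there (Any.there (Any.there (Any.here refl))))))

module _ {Γ : Ctx} {Δ : List (Fm Γ)} where

  cast : ∀ {A B} → A ≡ B → Δ ⊢ A → Δ ⊢ B
  cast refl d = d

  replace : ∀ {σ} {s t : Tm Γ σ} (A : Fm (σ ∷ Γ)) → Internal A →
            Δ ⊢ s ≐ t → Δ ⊢ A [ s ] → Δ ⊢ A [ t ]
  replace A i e d = ⊃E (⊃E (ax (eq-subst A i _ _)) e) d

  replace≡ : ∀ {σ} {s t : Tm Γ σ} {X Y} (A : Fm (σ ∷ Γ)) → Internal A → Δ ⊢ s ≐ t →
             A [ s ] ≡ X → A [ t ] ≡ Y → Δ ⊢ X → Δ ⊢ Y
  replace≡ A i e p q d = cast q (replace A i e (cast (sym p) d))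

  ≐refl : ∀ {σ} (t : Tm Γ σ) → Δ ⊢ t ≐ t
  ≐refl t = ax (eq-refl t)

  ≐sym : ∀ {σ} {s t : Tm Γ σ} → Δ ⊢ s ≐ t → Δ ⊢ t ≐ s
  ≐sym {s = s} {t} e =
    replace≡ (v0 ≐ wk s) i≐ e (cong (s ≐_) (sub0-wk s s)) (cong (t ≐_) (sub0-wk t s)) (≐refl s)

  ≐trans : ∀ {σ} {s t r : Tm Γ σ} → Δ ⊢ s ≐ t → Δ ⊢ t ≐ r → Δ ⊢ s ≐ r
  ≐trans {s = s} {t} {r} e e' =
    replace≡ (wk s ≐ v0) i≐ e' (cong (_≐ t) (sub0-wk t s)) (cong (_≐ r) (sub0-wk r s)) e

  cong-fun : ∀ {σ τ} {f g : Tm Γ (σ ⇒ τ)} (u : Tm Γ σ) → Δ ⊢ f ≐ g → Δ ⊢ f · u ≐ g · u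
  cong-fun {f = f} {g} u e = replace≡ (wk f · wk u ≐ v0 · wk u) i≐ e
    (cong₂ _≐_ (cong₂ _·_ (sub0-wk f f) (sub0-wk f u)) (cong (f ·_) (sub0-wk f u)))
    (cong₂ _≐_ (cong₂ _·_ (sub0-wk g f) (sub0-wk g u)) (cong (g ·_) (sub0-wk g u)))
    (≐refl (f · u))

  cong-arg : ∀ {σ τ} (f : Tm Γ (σ ⇒ τ)) {a b : Tm Γ σ} → Δ ⊢ a ≐ b → Δ ⊢ f · a ≐ f · b
  cong-arg f {a} {b} e = replace≡ (wk f · wk a ≐ wk f · v0) i≐ e
    (cong₂ _≐_ (cong₂ _·_ (sub0-wk a f) (sub0-wk a a)) (cong (_· a) (sub0-wk a f)))
    (cong₂ _≐_ (cong₂ _·_ (sub0-wk b f) (sub0-wk b a)) (cong (_· b) (sub0-wk b f)))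
    (≐refl (f · a))

  β : ∀ {σ τ} (t : Tm (σ ∷ Γ) τ) (u : Tm Γ σ) → Δ ⊢ lam t · u ≐ t [ u ]ₜ
  β t u = ax (beta t u)

  induction : (A : Fm (ι ∷ Γ)) → Internal A → Δ ⊢ A [ zer ] →
              Δ ⊢ ∀' ι (A ⊃ subF succSub A) → Δ ⊢ ∀' ι A
  induction A i b s = ⊃E (⊃E (ax (ind A i)) b) s

-- 3. Arithmetic of + and <

S' : ∀ {Γ} → Tm Γ ι → Tm Γ ι
S' t = suc · t

_+'_ : ∀ {Γ} → Tm Γ ι → Tm Γ ι → Tm Γ ι
a +' b = plus · a · b

plusStep : ∀ {Γ} → Tm Γ (ι ⇒ ι ⇒ ι)
plusStep = lam (lam (suc · v0))

plus-def : ∀ {Γ} {Δ : List (Fm Γ)} → Δ ⊢ ∀' ι (∀' ι (v1 +' v0 ≐ rec ι · v1 · plusStep · v0))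
plus-def = ∀I (∀I (≐trans (cong-fun v0 (β _ _)) (β _ _)))

plus-zero : ∀ {Γ} {Δ : List (Fm Γ)} → Δ ⊢ ∀' ι (v0 +' zer ≐ v0)
plus-zero = ∀I (≐trans (∀E (∀E plus-def v0) zer) (ax (rec-zer _ _)))

plus-suc : ∀ {Γ} {Δ : List (Fm Γ)} → Δ ⊢ ∀' ι (∀' ι (v1 +' S' v0 ≐ S' (v1 +' v0)))
plus-suc = ∀I (∀I (≐trans (∀E (∀E plus-def v1) (S' v0))
  (≐trans (ax (rec-suc _ _ _)) (≐trans (cong-fun _ (β _ _)) (≐trans (β _ _)
    (cong-arg suc (≐sym (∀E (∀E plus-def v1) v0))))))))

zero-plus : ∀ {Γ} {Δ : List (Fm Γ)} → Δ ⊢ ∀' ι (zer +' v0 ≐ v0)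
zero-plus = induction (zer +' v0 ≐ v0) i≐ (∀E plus-zero zer)
  (∀I (⊃I (≐trans (∀E (∀E plus-suc zer) v0) (cong-arg suc h0))))

suc-plus : ∀ {Γ} {Δ : List (Fm Γ)} → Δ ⊢ ∀' ι (∀' ι (S' v1 +' v0 ≐ S' (v1 +' v0)))
suc-plus = ∀I (induction (S' v1 +' v0 ≐ S' (v1 +' v0)) i≐
  (≐trans (∀E plus-zero (S' v0)) (cong-arg suc (≐sym (∀E plus-zero v0))))
  (∀I (⊃I (≐trans (∀E (∀E plus-suc (S' v1)) v0) (≐trans (cong-arg suc h0)
     (cong-arg suc (≐sym (∀E (∀E plus-suc v1) v0))))))))

zero-or-suc : ∀ {Γ} {Δ : List (Fm Γ)} → Δ ⊢ ∀' ι (v0 ≐ zer ∨' ∃' ι (v1 ≐ S' v0))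
zero-or-suc = induction (v0 ≐ zer ∨' ∃' ι (v1 ≐ S' v0)) (i∨ i≐ (i∃ i≐)) (∨I₁ (≐refl zer))
  (∀I (⊃I (∨I₂ (∃I v0 (≐refl _)))))

<'-internal : ∀ {Γ} {a b : Tm Γ ι} → Internal (a <' b)
<'-internal = i∃ i≐

≮zero : ∀ {Γ} {Δ : List (Fm Γ)} → Δ ⊢ ∀' ι ((v0 <' zer) ⊃ ⊥')
≮zero = ∀I (⊃I (∃E h0 (⊃E (ax (suc-nz _)) h0)))

<suc-inv : ∀ {Γ} {Δ : List (Fm Γ)} →
  Δ ⊢ ∀' ι (∀' ι ((v0 <' S' v1) ⊃ (v0 ≐ zer ∨' ∃' ι (v1 ≐ S' v0 ∧' (v0 <' v2)))))
<suc-inv = ∀I (∀I (⊃I (∃E h0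
  (∨E (∀E zero-or-suc v1) (∨I₁ h0)
    (∃E h0 (∨I₂ (∃I v0 (∧I h0 (∃I v1
      (≐trans (≐sym (∀E (∀E suc-plus v0) v1))
      (≐trans (cong-fun v1 (cong-arg plus (≐sym h0)))
        (⊃E (ax (suc-inj _ _)) h2))))))))))))

zero<suc : ∀ {Γ} {Δ : List (Fm Γ)} → Δ ⊢ ∀' ι (zer <' S' v0)
zero<suc = ∀I (∃I v0 (cong-arg suc (∀E zero-plus v0)))

suc<suc : ∀ {Γ} {Δ : List (Fm Γ)} → Δ ⊢ ∀' ι (∀' ι ((v0 <' v1) ⊃ (S' v0 <' S' v1)))
suc<suc = ∀I (∀I (⊃I (∃E h0 (∃I v0 (cong-arg suc (≐trans (∀E (∀E suc-plus v1) v0) h0))))))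

-- 4. Length, projection and membership

v3 : ∀ {Γ σ τ ρ κ} → Tm (κ ∷ ρ ∷ τ ∷ σ ∷ Γ) σ
v3 = var (there (there (there here)))

v4 : ∀ {Γ σ τ ρ κ μ} → Tm (μ ∷ κ ∷ ρ ∷ τ ∷ σ ∷ Γ) σ
v4 = var (there (there (there (there here))))

v5 : ∀ {Γ σ τ ρ κ μ ν} → Tm (ν ∷ μ ∷ κ ∷ ρ ∷ τ ∷ σ ∷ Γ) σ
v5 = var (there (there (there (there (there here)))))

cns : ∀ {Γ} σ → Tm Γ σ → Tm Γ (σ *) → Tm Γ (σ *)
cns σ a s = cons σ · a · s

lenF : ∀ {Γ} σ → Tm Γ (σ * ⇒ ι)
lenF σ = lrec σ ι · zer · lam (lam (lam (suc · v0)))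

projStep : ∀ {Γ} σ → Tm Γ (σ ⇒ σ * ⇒ (ι ⇒ σ) ⇒ ι ⇒ σ)
projStep σ = lam (lam (lam (lam (rec σ · var (there (there (there here)))
                                      · lam (lam (var (there (there (there here))) · v1))
                                      · v0))))

-- s_i with default function d: its value at positions beyond the length is
-- d applied to the excess.  Defs.proj is the instance d = λi.dflt.
projF : ∀ {Γ} σ → Tm Γ (ι ⇒ σ) → Tm Γ (σ *) → Tm Γ (ι ⇒ σ)
projF σ d s = lrec σ (ι ⇒ σ) · d · projStep σ · s

-- a ∈ s, with the default function e given inside the binder of the position.
-- Defs.mem a s is literally  memAt σ (dflt (ι ⇒ σ)) a s.
memAt : ∀ {Γ} σ → Tm (ι ∷ Γ) (ι ⇒ σ) → Tm Γ σ → Tm Γ (σ *) → Fm Γ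
memAt σ e a s = ∃' ι ((v0 <' len (wk s)) ∧' (wk a ≐ lrec σ (ι ⇒ σ) · e · projStep σ · wk s · v0))

-- a ∈ s for a default function d in the ambient context.  Keeping d a
-- variable makes substitution into membership compute definitionally.
memD : ∀ {Γ} σ → Tm Γ (ι ⇒ σ) → Tm Γ σ → Tm Γ (σ *) → Fm Γ
memD σ d a s = memAt σ (wk d) a s

memAt-internal : ∀ {Γ} σ {e a s} → Internal {Γ} (memAt σ e a s)
memAt-internal σ = i∃ (i∧ <'-internal i≐)

mem-internal : ∀ {Γ} σ {a : Tm Γ σ} {s} → Internal (mem a s)
mem-internal σ = memAt-internal σ

len-nil : ∀ σ {Γ} {Δ : List (Fm Γ)} → Δ ⊢ len (nil σ) ≐ zer
len-nil σ = ax (lrec-nil _ _)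

len-cons : ∀ σ {Γ} {Δ : List (Fm Γ)} → Δ ⊢ ∀' σ (∀' (σ *) (len (cns σ v1 v0) ≐ S' (len v0)))
len-cons σ = ∀I (∀I (≐trans (ax (lrec-cons _ _ _ _))
  (≐trans (cong-fun _ (cong-fun _ (β _ _))) (≐trans (cong-fun _ (β _ _)) (β _ _)))))

cons-len≢zero : ∀ σ {Γ} {Δ : List (Fm (σ * ∷ σ ∷ σ * ∷ Γ))} →
  Δ ⊢ v2 ≐ cns σ v1 v0 → Δ ⊢ len v2 ≐ zer → Δ ⊢ ⊥'
cons-len≢zero σ e l = ⊃E (ax (suc-nz (len v0)))
  (≐trans (≐sym (∀E (∀E (len-cons σ) v1) v0)) (≐trans (cong-arg (lenF σ) (≐sym e)) l))

cons-len-suc : ∀ σ {Γ} {Δ : List (Fm (σ * ∷ σ ∷ σ * ∷ ι ∷ Γ))} →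
  Δ ⊢ v2 ≐ cns σ v1 v0 → Δ ⊢ len v2 ≐ S' v3 → Δ ⊢ len v0 ≐ v3
cons-len-suc σ e l = ⊃E (ax (suc-inj _ _))
  (≐trans (≐sym (∀E (∀E (len-cons σ) v1) v0)) (≐trans (cong-arg (lenF σ) (≐sym e)) l))

nil-len≢suc : ∀ σ {Γ} {Δ : List (Fm (σ * ∷ ι ∷ Γ))} →
  Δ ⊢ v0 ≐ nil σ → Δ ⊢ len v0 ≐ S' v1 → Δ ⊢ ⊥'
nil-len≢suc σ e l = ⊃E (ax (suc-nz v1)) (≐trans (≐sym l) (≐trans (cong-arg (lenF σ) e) (len-nil σ)))

proj-cons-zero : ∀ σ {Γ} {Δ : List (Fm Γ)} →
  Δ ⊢ ∀' (ι ⇒ σ) (∀' σ (∀' (σ *) (projF σ v2 (cns σ v1 v0) · zer ≐ v1)))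
proj-cons-zero σ = ∀I (∀I (∀I (≐trans (cong-fun zer (ax (lrec-cons _ _ _ _)))
  (≐trans (cong-fun _ (cong-fun _ (cong-fun _ (β _ _))))
  (≐trans (cong-fun _ (cong-fun _ (β _ _)))
  (≐trans (cong-fun _ (β _ _)) (≐trans (β _ _) (ax (rec-zer _ _)))))))))

proj-cons-suc : ∀ σ {Γ} {Δ : List (Fm Γ)} →
  Δ ⊢ ∀' (ι ⇒ σ) (∀' σ (∀' (σ *) (∀' ι (projF σ v3 (cns σ v2 v1) · S' v0 ≐ projF σ v3 v1 · v0))))
proj-cons-suc σ = ∀I (∀I (∀I (∀I (≐trans (cong-fun _ (ax (lrec-cons _ _ _ _)))
  (≐trans (cong-fun _ (cong-fun _ (cong-fun _ (β _ _))))
  (≐trans (cong-fun _ (cong-fun _ (β _ _)))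
  (≐trans (cong-fun _ (β _ _)) (≐trans (β _ _) (≐trans (ax (rec-suc _ _ _))
  (≐trans (cong-fun _ (β _ _)) (β _ _)))))))))))

∉nil : ∀ σ {Γ} {Δ : List (Fm Γ)} → Δ ⊢ ∀' (ι ⇒ σ) (∀' σ (memD σ v1 v0 (nil σ) ⊃ ⊥'))
∉nil σ = ∀I (∀I (⊃I (∃E h0 (⊃E (∀E ≮zero v0) (replace (v1 <' v0) <'-internal (len-nil σ) (∧E₁ h0))))))

∈cons-head : ∀ σ {Γ} {Δ : List (Fm Γ)} → Δ ⊢ ∀' (ι ⇒ σ) (∀' σ (∀' (σ *) (memD σ v2 v1 (cns σ v1 v0))))
∈cons-head σ = ∀I (∀I (∀I (∃I zer (∧I
  (replace (zer <' v0) <'-internal (≐sym (∀E (∀E (len-cons σ) v1) v0)) (∀E zero<suc (len v0)))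
  (≐sym (∀E (∀E (∀E (proj-cons-zero σ) v2) v1) v0))))))

∈cons-tail : ∀ σ {Γ} {Δ : List (Fm Γ)} →
  Δ ⊢ ∀' (ι ⇒ σ) (∀' σ (∀' (σ *) (∀' σ (memD σ v3 v0 v1 ⊃ memD σ v3 v0 (cns σ v2 v1)))))
∈cons-tail σ = ∀I (∀I (∀I (∀I (⊃I (∃E h0 (∃I (S' v0) (∧I
  (replace (S' v1 <' v0) <'-internal (≐sym (∀E (∀E (len-cons σ) v3) v2))
    (⊃E (∀E (∀E suc<suc (len v2)) v0) (∧E₁ h0)))
  (≐trans (∧E₂ h0) (≐sym (∀E (∀E (∀E (∀E (proj-cons-suc σ) v4) v3) v2) v0))))))))))

∈cons-inv : ∀ σ {Γ} {Δ : List (Fm Γ)} →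
  Δ ⊢ ∀' (ι ⇒ σ) (∀' σ (∀' (σ *) (∀' σ (memD σ v3 v0 (cns σ v2 v1) ⊃ (v0 ≐ v2 ∨' memD σ v3 v0 v1)))))
∈cons-inv σ = ∀I (∀I (∀I (∀I (⊃I (∃E h0
  (∨E (⊃E (∀E (∀E <suc-inv (len v2)) v0)
            (replace (v1 <' v0) <'-internal (∀E (∀E (len-cons σ) v3) v2) (∧E₁ h0)))
    (∨I₁ (≐trans (∧E₂ h1) (≐trans (cong-arg (projF σ v4 (cns σ v3 v2)) h0)
        (∀E (∀E (∀E (proj-cons-zero σ) v4) v3) v2))))
    (∃E h0 (∨I₂ (∃I v0 (∧I (∧E₂ h0)
      (≐trans (∧E₂ h2) (≐trans (cong-arg (projF σ v5 (cns σ v4 v3)) (∧E₁ h0))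
        (∀E (∀E (∀E (∀E (proj-cons-suc σ) v5) v4) v3) v0)))))))))))))

-- 5. Induction over lists

-- The substitution s ↦ x ∷ t; subF (consSub σ) P is P(x ∷ t) in context (t, x, Γ).
consSub : ∀ {Γ} σ → Sub (σ * ∷ Γ) (σ * ∷ σ ∷ Γ)
consSub σ here      = cns σ v1 v0
consSub σ (there x) = var (there (there x))

-- The proof is
-- induction on n for  Q(n) :≡ ∀s (|s| = n → P(s)),  splitting s into [] or x ∷ t
-- (axiom seq-cases) and using |[]| = 0, |x ∷ t| = |t| + 1.
module ListInduction (σ : Ty) {Γ : Ctx} (P : Fm (σ * ∷ Γ)) (iP : Internal P) where

  -- P(s) with a fresh variable (n or another list) inserted below s
  P↑ : ∀ {τ} → Fm (σ * ∷ τ ∷ Γ)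
  P↑ = renF (extR there) P

  Q : Fm (ι ∷ Γ)
  Q = ∀' (σ *) ((len v0 ≐ v1) ⊃ P↑)

  Q-internal : Internal Q
  Q-internal = i∀ (i⊃ i≐ (renF-internal _ iP))

  Step : Fm Γ
  Step = ∀' σ (∀' (σ *) (P↑ ⊃ subF (consSub σ) P))

  P↑-inst : ∀ {τ} (u : Tm Γ τ) → subF (extS (sub0 u)) P↑ ≡ P
  P↑-inst u = trans (subF-renF _ _ P) (trans (subF-cong (λ { here → refl ; (there x) → refl }) P) (subF-var P))

  P↑-succ : subF (extS succSub) (P↑ {ι}) ≡ P↑
  P↑-succ = trans (subF-renF _ _ P) (trans (subF-cong (λ { here → refl ; (there x) → refl }) P)
              (sym (renF-as-subF _ P)))

  -- P↑ {σ *} is the template for rewriting along s = []: instantiated at []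
  -- it is P([]) (weakened), instantiated at s it is P(s).
  P↑-nil : P↑ {σ *} [ nil σ ] ≡ wkF (P [ nil σ ])
  P↑-nil = trans (subF-renF _ _ P) (trans (subF-cong (λ { here → refl ; (there x) → refl }) P)
             (sym (trans (renF-as-subF there (P [ nil σ ])) (subF-subF _ _ P))))

  P↑-self : P↑ {σ *} [ v0 ] ≡ P
  P↑-self = trans (subF-renF _ _ P) (trans (subF-cong (λ { here → refl ; (there x) → refl }) P) (subF-var P))

  base : ∀ {Δ} → (Step ∷ P [ nil σ ] ∷ Δ) ⊢ Q [ zer ]
  base = ∀I (⊃I (cast (sym (P↑-inst zer)) (∨E (ax (seq-cases v0))
    (cast P↑-self (replace (P↑ {σ *}) (renF-internal _ iP) (≐sym h0) (cast (sym P↑-nil) h3)))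
    (∃E h0 (∃E h0 (⊥E (cons-len≢zero σ h0 h3)))))))

  -- Context of the cons case of the step: s = x ∷ t with |s| = n + 1.
  K : Ctx
  K = σ * ∷ σ ∷ σ * ∷ ι ∷ Γ

  atTail atCons atList : Sub (σ * ∷ Γ) K
  atTail here      = v0
  atTail (there x) = var (there (there (there (there x))))
  atCons here      = cns σ v1 v0
  atCons (there x) = var (there (there (there (there x))))
  atList here      = v2
  atList (there x) = var (there (there (there (there x))))

  ρK : Ren (σ * ∷ Γ) (σ * ∷ K)
  ρK here      = here
  ρK (there x) = there (there (there (there (there x))))

  Q-at-tail : subF (sub0 v0) (renF (extR there) (renF (extR there) (renF (extR there) (renF (extR there) P))))
              ≡ subF atTail P
  Q-at-tail = trans (cong (subF (sub0 v0)) (trans (cong (renF _) (cong (renF _) (renF-renF _ _ P)))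
                (trans (cong (renF _) (renF-renF _ _ P)) (renF-renF _ _ P))))
              (trans (subF-renF _ _ P) (subF-cong (λ { here → refl ; (there x) → refl }) P))

  e2 : ∀ {Γ₁ τ₁ τ₂ τ₃} → Ren (τ₁ ∷ τ₂ ∷ Γ₁) (τ₁ ∷ τ₂ ∷ τ₃ ∷ Γ₁)
  e2 = extR (extR there)

  Step-premise : subF (sub0 v0) (subF (extS (sub0 v1)) (renF e2 (renF e2 (renF e2 (renF e2 (renF (extR there) P))))))
                 ≡ subF atTail P
  Step-premise = trans (cong (λ z → subF (sub0 v0) (subF (extS (sub0 v1)) z))
      (trans (cong (renF _) (cong (renF _) (cong (renF _) (renF-renF _ _ P))))
      (trans (cong (renF _) (cong (renF _) (renF-renF _ _ P)))
      (trans (cong (renF _) (renF-renF _ _ P)) (renF-renF _ _ P)))))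
    (trans (cong (subF (sub0 v0)) (subF-renF _ _ P)) (trans (subF-subF _ _ P)
      (subF-cong (λ { here → refl ; (there x) → refl }) P)))

  Step-conclusion : subF (sub0 v0) (subF (extS (sub0 v1))
                      (renF e2 (renF e2 (renF e2 (renF e2 (subF (consSub σ) P))))))
                    ≡ subF atCons P
  Step-conclusion = trans (cong (λ z → subF (sub0 v0) (subF (extS (sub0 v1)) z))
      (trans (cong (renF _) (cong (renF _) (cong (renF _) (renF-subF _ _ P))))
      (trans (cong (renF _) (cong (renF _) (renF-subF _ _ P)))
      (trans (cong (renF _) (renF-subF _ _ P)) (renF-subF _ _ P)))))
    (trans (cong (subF (sub0 v0)) (subF-subF _ _ P)) (trans (subF-subF _ _ P)
      (subF-cong (λ { here → refl ; (there x) → refl }) P)))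

  at-cons : subF atCons P ≡ (renF ρK P) [ cns σ v1 v0 ]
  at-cons = sym (trans (subF-renF _ _ P) (subF-cong (λ { here → refl ; (there x) → refl }) P))

  at-list : (renF ρK P) [ v2 ] ≡ subF atList P
  at-list = trans (subF-renF _ _ P) (subF-cong (λ { here → refl ; (there x) → refl }) P)

  at-list-goal : subF atList P ≡ renF there (renF there (P↑ {ι}))
  at-list-goal = sym (trans (cong (renF there) (renF-renF _ _ P)) (trans (renF-renF _ _ P)
    (trans (renF-as-subF _ P) (subF-cong (λ { here → refl ; (there x) → refl }) P))))

  step : ∀ {Δ} → (Step ∷ P [ nil σ ] ∷ Δ) ⊢ ∀' ι (Q ⊃ subF succSub Q)
  step = ∀I (⊃I (∀I (⊃I (cast (sym P↑-succ) (∨E (ax (seq-cases v0))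
    (⊥E (nil-len≢suc σ h0 h1))
    (∃E h0 (∃E h0 (cast (trans at-list at-list-goal) (replace (renF ρK P) (renF-internal _ iP) (≐sym h0)
      (cast at-cons (cast Step-conclusion (⊃E (∀E (∀E h5 v1) v0)
        (cast (trans Q-at-tail (sym Step-premise)) (⊃E (∀E h4 v0) (cons-len-suc σ h0 h3)))))))))))))))

  Q-diagonal : subF (sub0 v0) (subF (extS (sub0 (len v0))) (renF (extR (extR there)) P↑)) ≡ P
  Q-diagonal = trans (cong (λ z → subF (sub0 v0) (subF (extS (sub0 (len v0))) z)) (renF-renF _ _ P))
    (trans (cong (subF (sub0 v0)) (subF-renF _ _ P)) (trans (subF-subF _ _ P)
      (trans (subF-cong (λ { here → refl ; (there x) → refl }) P) (subF-var P))))

  listInduction : ∀ {Δ} → Δ ⊢ P [ nil σ ] ⊃ (Step ⊃ ∀' (σ *) P)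
  listInduction = ⊃I (⊃I (⊃E (⊃I (∀I (cast Q-diagonal (⊃E (∀E (∀E h0 (len v0)) v0) (≐refl _)))))
                            (induction Q Q-internal base step)))

list-ind : ∀ σ {Γ} {Δ : List (Fm Γ)} (P : Fm (σ * ∷ Γ)) → Internal P → Δ ⊢ P [ nil σ ] →
  Δ ⊢ ∀' σ (∀' (σ *) (renF (extR there) P ⊃ subF (consSub σ) P)) → Δ ⊢ ∀' (σ *) P
list-ind σ P iP b s = ⊃E (⊃E (ListInduction.listInduction σ P iP) b) s

-- 6. Append and flatten

appStep : ∀ {Γ} σ → Tm Γ (σ ⇒ σ * ⇒ σ * ⇒ σ *)
appStep σ = lam (lam (lam (cons σ · v2 · v0)))

app : ∀ {Γ} σ → Tm Γ (σ *) → Tm Γ (σ *) → Tm Γ (σ *)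
app σ a b = lrec σ (σ *) · b · appStep σ · a

flatStep : ∀ {Γ} σ → Tm Γ (σ * ⇒ (σ *) * ⇒ σ * ⇒ σ *)
flatStep σ = lam (lam (lam (app σ v2 v0)))

flatF : ∀ {Γ} σ → Tm Γ ((σ *) * ⇒ σ *)
flatF σ = lrec (σ *) (σ *) · nil σ · flatStep σ

flat : ∀ {Γ} σ → Tm Γ ((σ *) *) → Tm Γ (σ *)
flat σ T = flatF σ · T

app-nil : ∀ σ {Γ} {Δ : List (Fm Γ)} → Δ ⊢ ∀' (σ *) (app σ (nil σ) v0 ≐ v0)
app-nil σ = ∀I (ax (lrec-nil _ _))

app-cons : ∀ σ {Γ} {Δ : List (Fm Γ)} →
  Δ ⊢ ∀' σ (∀' (σ *) (∀' (σ *) (app σ (cns σ v2 v1) v0 ≐ cns σ v2 (app σ v1 v0))))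
app-cons σ = ∀I (∀I (∀I (≐trans (ax (lrec-cons _ _ _ _))
  (≐trans (cong-fun _ (cong-fun _ (β _ _))) (≐trans (cong-fun _ (β _ _)) (β _ _))))))

flat-cons : ∀ σ {Γ} {Δ : List (Fm Γ)} →
  Δ ⊢ ∀' (σ *) (∀' ((σ *) *) (flat σ (cns (σ *) v1 v0) ≐ app σ v1 (flat σ v0)))
flat-cons σ = ∀I (∀I (≐trans (ax (lrec-cons _ _ _ _))
  (≐trans (cong-fun _ (cong-fun _ (β _ _))) (≐trans (cong-fun _ (β _ _)) (β _ _)))))

∈app-left : ∀ σ {Γ} {Δ : List (Fm Γ)} →
  Δ ⊢ ∀' (ι ⇒ σ) (∀' (σ *) (∀' (σ *) (∀' σ (memD σ v3 v0 v2 ⊃ memD σ v3 v0 (app σ v2 v1)))))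
∈app-left σ = ∀I (list-ind σ _ (i∀ (i∀ (i⊃ (memAt-internal σ) (memAt-internal σ))))
  (∀I (∀I (⊃I (⊥E (⊃E (∀E (∀E (∉nil σ) v2) v0) h0)))))
  (∀I (∀I (⊃I (∀I (∀I (⊃I
    (replace (memD σ v5 v1 v0) (memAt-internal σ) (≐sym (∀E (∀E (∀E (app-cons σ) v3) v2) v1))
      (∨E (⊃E (∀E (∀E (∀E (∀E (∈cons-inv σ) v4) v3) v2) v0) h0)
        (replace (memD σ v5 v0 (cns σ v4 (app σ v3 v2))) (memAt-internal σ) (≐sym h0)
           (∀E (∀E (∀E (∈cons-head σ) v4) v3) (app σ v2 v1)))
        (⊃E (∀E (∀E (∀E (∀E (∈cons-tail σ) v4) v3) (app σ v2 v1)) v0)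
           (⊃E (∀E (∀E h2 v1) v0) h0)))))))))))

∈app-right : ∀ σ {Γ} {Δ : List (Fm Γ)} →
  Δ ⊢ ∀' (ι ⇒ σ) (∀' (σ *) (∀' (σ *) (∀' σ (memD σ v3 v0 v1 ⊃ memD σ v3 v0 (app σ v2 v1)))))
∈app-right σ = ∀I (list-ind σ _ (i∀ (i∀ (i⊃ (memAt-internal σ) (memAt-internal σ))))
  (∀I (∀I (⊃I (replace (memD σ v3 v1 v0) (memAt-internal σ) (≐sym (∀E (app-nil σ) v1)) h0))))
  (∀I (∀I (⊃I (∀I (∀I (⊃I
    (replace (memD σ v5 v1 v0) (memAt-internal σ) (≐sym (∀E (∀E (∀E (app-cons σ) v3) v2) v1))
      (⊃E (∀E (∀E (∀E (∀E (∈cons-tail σ) v4) v3) (app σ v2 v1)) v0)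
           (⊃E (∀E (∀E h1 v1) v0) h0))))))))))

-- The key fact:  t ∈ T → t ⊆ flat(T),  by induction on T using the two
-- lemmas above for flat(t ∷ T) = t · flat(T).  Both default functions
-- (for σ* and for σ) are kept as variables.
⊆flat : ∀ σ {Γ} {Δ : List (Fm Γ)} →
  Δ ⊢ ∀' (ι ⇒ σ *) (∀' (ι ⇒ σ) (∀' ((σ *) *) (∀' (σ *)
      (memD (σ *) v3 v0 v1 ⊃ ∀' σ (memD σ v3 v0 v1 ⊃ memD σ v3 v0 (flat σ v2))))))
⊆flat σ = ∀I (∀I (list-ind (σ *) _
  (i∀ (i⊃ (memAt-internal _) (i∀ (i⊃ (memAt-internal σ) (memAt-internal σ)))))
  (∀I (⊃I (⊥E (⊃E (∀E (∀E (∉nil (σ *)) v2) v0) h0))))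
  (∀I (∀I (⊃I (∀I (⊃I (∀I (⊃I
    (replace (memD σ v5 v1 v0) (memAt-internal σ) (≐sym (∀E (∀E (flat-cons σ) v3) v2))
      (∨E (⊃E (∀E (∀E (∀E (∀E (∈cons-inv (σ *)) v5) v3) v2) v1) h1)
        (⊃E (∀E (∀E (∀E (∀E (∈app-left σ) v4) v3) (flat σ v2)) v0)
           (replace (memD σ v5 v1 v0) (memAt-internal σ) h0 h1))
        (⊃E (∀E (∀E (∀E (∀E (∈app-right σ) v4) v3) (flat σ v2)) v0)
           (⊃E (∀E (⊃E (∀E h3 v1) h0) v0) h1)))))))))))))

-- The default values for σ are only required to be dflt σ
-- up to syntactic identity: substitution does not compute on dflt of an
-- abstract type, while dflt (σ *) = nil σ is stable.
⊆flat-dflt : ∀ σ {Γ} {Δ : List (Fm (σ * ∷ (σ *) * ∷ Γ))} {z₁ z₂} →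
  z₁ ≡ dflt σ → z₂ ≡ dflt σ → Δ ⊢ memAt (σ *) (dflt (ι ⇒ σ *)) v0 v1 →
  Δ ⊢ ∀' σ (memAt σ (lam z₁) v0 v1 ⊃ memAt σ (lam z₂) v0 (flat σ v2))
⊆flat-dflt σ refl refl t∈T =
  cast (cong₂ (λ z₁ z₂ → ∀' σ (memAt σ (lam z₁) v0 v1 ⊃ memAt σ (lam z₂) v0 (flat σ v2)))
         (sub-isDflt _ (sub-isDflt _ (ren-isDflt _ (ren-isDflt _ (ren-isDflt _ (ren-isDflt _ refl))))))
         (sub-isDflt _ (sub-isDflt _ (ren-isDflt _ (ren-isDflt _ (ren-isDflt _ (ren-isDflt _ refl)))))))
    (⊃E (∀E (∀E (∀E (∀E (⊆flat σ) (dflt (ι ⇒ σ *))) (dflt (ι ⇒ σ))) v1) v0) t∈T)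

module US*-Proof {Γ : Ctx} (σ : Ty) (φ : Fm (σ * ∷ Γ)) (iφ : Internal φ) where

  Hyp : Fm Γ
  Hyp = ∀' (σ *) (hyper σ v0 ⊃ φ)

  -- Good(t, s) :≡ t ⊆ s → φ(s)  with t = var 0 and s = var 1
  Good : Fm (σ * ∷ σ * ∷ Γ)
  Good = ∀' σ (mem v0 v1 ⊃ renF (extR there) (mem v0 v1)) ⊃ wkF φ

  Good-internal : Internal Good
  Good-internal = i⊃ (i∀ (i⊃ (mem-internal σ) (renF-internal _ (mem-internal σ))))
                     (renF-internal there iφ)

  φ-self : subF (sub0 v0) (renF (extR there) φ) ≡ φ
  φ-self = trans (subF-renF _ _ φ) (trans (subF-cong (λ { here → refl ; (there x) → refl }) φ) (subF-var φ))

  -- Step 1 (HGMP^st with φ(x) :≡ x ∈ s, ψ :≡ φ(s)): since hyper(s) → φ(s),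
  -- every s has a standard t with Good(t, s).
  good-witness : (Hyp ∷ []) ⊢ ∀' (σ *) (∃st (σ *) Good)
  good-witness = ∀I (⊃E (ax (hgmp (mem v0 v1) φ (mem-internal σ) iφ))
    (cast (cong₂ _⊃_ (cong (λ z → ∀' σ (st v0 ⊃ memAt σ (lam z) v0 v1)) (sub-isDflt _ (ren-isDflt _ refl)))
                     φ-self)
          (∀E h0 v0)))

  GoodList : Fm ((σ *) * ∷ Γ)
  GoodList = ∀' (σ *) (∃' (σ *) (mem v0 v2 ∧' renF skip2 Good))

  collect : (Hyp ∷ []) ⊢ ∃st ((σ *) *) GoodList
  collect = ⊃E (ax (R Good Good-internal)) good-witness

  u : Tm ((σ *) * ∷ Γ) (σ *)
  u = flat σ v0

  flat-standard : ∀ {Δ} → Δ ⊢ st v0 → Δ ⊢ st u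
  flat-standard stT = ⊃E (ax (st-app (flatF σ) v0)) (∧I (ax (st-closed (flatF σ))) stT)

  φ-at-flat : subF (extS (sub0 u)) (renF (skip2 {Γ} {σ *} {σ *} {(σ *) *}) (renF (there {τ = σ *}) φ))
              ≡ renF there (subF (sub0 u) (renF (extR there) φ))
  φ-at-flat = trans (cong (subF _) (renF-renF _ _ φ)) (trans (subF-renF _ _ φ)
    (sym (trans (cong (renF there) (subF-renF _ _ φ))
      (trans (renF-subF _ _ φ) (subF-cong (λ { here → refl ; (there x) → refl }) φ)))))

  φ-flat : ((st v0 ∧' GoodList) ∷ map wkF (Hyp ∷ [])) ⊢ wkF (∃st (σ *) φ)
  φ-flat = ∃I u (∧I (flat-standard (∧E₁ h0))
    (∃E (∀E (∧E₂ h0) u)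
      (cast φ-at-flat (⊃E (∧E₂ h0)
        (⊆flat-dflt σ (sub-isDflt _ (ren-isDflt _ refl)) (sub-isDflt _ (ren-isDflt _ (ren-isDflt _ refl)))
                    (∧E₁ h0))))))

mainTheorem4 : ∀ {Γ : Ctx} (σ : Ty) (φ : Fm (σ * ∷ Γ)) → Internal φ →
    [] ⊢ US* σ φ
mainTheorem4 σ φ iφ = ⊃I (∃E collect φ-flat)
  where open US*-Proof σ φ iφ
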